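{- Let $p$ be a positive integer. A graph $G$ is a $\mathbf{W}_{p}$ graph if and only if each of its connected components is a $\mathbf{W}_{p}$ graph.
   Context: All graphs are finite, simple, undirected and loopless. An independent set is a set of pairwise non-adjacent vertices; $\alpha(G)$ is the maximum size of an independent set, and a maximum independent set is one of size $\alpha(G)$. For a positive integer $p$, a graph $G$ with $n(G)$ vertices is a $\mathbf{W}_{p}$ graph if $n(G)\geq p$ and for every $p$ pairwise disjoint independent sets $A_1,\ldots,A_p$ of $G$ there exist $p$ pairwise disjoint maximum independent sets $S_1,\ldots,S_p$ of $G$ with $A_i\subseteq S_i$ for $1\le i\le p$. -}

module Defs where

open import Data.Nat using (ℕ; suc; _≤_)
open import Data.Bool using (Bool; true; false)
open import Data.Fin using (Fin)
open import Data.Fin.Subset using (Subset; _∈_; _⊆_; ∣_∣)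
open import Data.Product using (Σ; _×_; ∃; ∃-syntax)
open import Relation.Binary.PropositionalEquality using (_≡_; _≢_)
open import Function.Definitions using (Injective)
open import Data.Empty using (⊥)

record Graph : Set where
  field
    n     : ℕ
    adj   : Fin n → Fin n → Bool
    sym   : ∀ x y → adj x y ≡ adj y x
    loopless : ∀ x → adj x x ≡ false

open Graph public

Adj : (G : Graph) → Fin (n G) → Fin (n G) → Set
Adj G x y = adj G x y ≡ true

Independent : (G : Graph) → Subset (n G) → Set
Independent G S = ∀ x y → x ∈ S → y ∈ S → Adj G x y → ⊥

MaximumIndependent : (G : Graph) → Subset (n G) → Set
MaximumIndependent G S =
  Independent G S × (∀ T → Independent G T → ∣ T ∣ ≤ ∣ S ∣)

Disjoint : {m : ℕ} → Subset m → Subset m → Set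
Disjoint A B = ∀ x → x ∈ A → x ∈ B → ⊥

PairwiseDisjoint : {m p : ℕ} → (Fin p → Subset m) → Set
PairwiseDisjoint {p = p} A = ∀ (i j : Fin p) → i ≢ j → Disjoint (A i) (A j)

W : ℕ → Graph → Set
W p G =
  p ≤ n G ×
  ((A : Fin p → Subset (n G)) →
   (∀ i → Independent G (A i)) →
   PairwiseDisjoint A →
   Σ (Fin p → Subset (n G)) λ S →
     (∀ i → MaximumIndependent G (S i)) ×
     PairwiseDisjoint S ×
     (∀ i → A i ⊆ S i))

data Reachable (G : Graph) : Fin (n G) → Fin (n G) → Set where
  here : ∀ {x} → Reachable G x x
  step : ∀ {x y z} → Adj G x y → Reachable G y z → Reachable G x z

Connected : Graph → Set
Connected H = 1 ≤ n H × (∀ x y → Reachable H x y)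

-- H is (a copy of) a connected component of G: an injective map
-- e : V(H) → V(G) that makes H the induced subgraph of G on its image,
-- H is connected, and the image is closed under G-adjacency
-- (hence the image is a maximal connected vertex set of G).
record IsComponent (H G : Graph) : Set where
  field
    emb       : Fin (n H) → Fin (n G)
    injective : Injective _≡_ _≡_ emb
    induced   : ∀ a b → adj H a b ≡ adj G (emb a) (emb b)
    connected : Connected H
    closed    : ∀ a y → Adj G (emb a) y → ∃[ b ] emb b ≡ y

-- A maximum independent set S of G meets every component H of G in a maximum independent
-- set of H: no edge leaves H, so any independent set of H can replace S ∩ H inside S, and
-- maximality of S bounds its size by ∣ S ∩ H ∣.  Hence disjoint maximum independent sets of G
-- extending the images of disjoint independent sets of H restrict to such an extension in H.
-- Conversely, solve the extension problem in every component and take the union of the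
-- solutions; it is maximum because replacing an independent set of G by it one component at
-- a time never decreases its size.  In both directions p ≤ n follows from the extension
-- property applied to empty sets, which yields p disjoint nonempty sets.

module Submission where

open import Defs hiding (sym)
open import Data.Nat using (ℕ; zero; suc; _+_; _≤_; _<_; z≤n; s≤s)
open import Data.Nat.Properties
  using (+-suc; +-monoˡ-≤; +-cancelʳ-≤; ≤-refl; ≤-trans; ≤-reflexive; <⇒≱; module ≤-Reasoning)
import Data.Bool as Bool
open import Data.Fin using (Fin; zero; suc; fromℕ<)
open import Data.Fin.Properties using (suc-injective; 0≢1+n; injective⇒≤; _≟_; any?; toℕ<n)
open import Data.Fin.Subset
  using (Subset; _∈_; _∉_; _⊆_; ∣_∣; _∩_; _∪_; ∁; ⁅_⁆; ⊤; Nonempty; inside; outside)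
  renaming (⊥ to ∅)
open import Data.Fin.Subset.Properties
  using ( _∈?_; _⊂?_; nonempty?; ∈⊤; x∈⁅x⁆; x∈⁅y⁆⇒x≡y; x∈p∩q⁺; x∈p∩q⁻; x∈p∪q⁺; x∈p∪q⁻
        ; x∈∁p⇒x∉p; p⊆p∪q; ⊆-antisym; ∣⁅x⁆∣≡1; ∣p∣≤n; p⊆q⇒∣p∣≤∣q∣; p⊂q⇒∣p∣<∣q∣ )
  renaming (∣⊥∣≡0 to ∣∅∣≡0; ∉⊥ to ∉∅)
open import Data.Vec using ([]; _∷_; tabulate; here; there)
open import Data.List using (List; []; _∷_; foldr; allFin)
import Data.List.Relation.Unary.Any as Any
open import Data.List.Membership.Propositional using () renaming (_∈_ to _∈L_)
open import Data.List.Membership.Propositional.Properties using (∈-allFin)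
open import Data.Vec.Properties using ([]=⇒lookup; lookup⇒[]=; lookup∘tabulate)
open import Data.Product using (Σ; _×_; _,_; proj₁; proj₂; ∃-syntax)
open import Data.Sum using (_⊎_; inj₁; inj₂)
open import Data.Empty using (⊥-elim)
open import Function using (_∘_)
open import Function.Bundles using (_⇔_; mk⇔)
open import Function.Definitions using (Injective)
open import Relation.Nullary using (yes; no; does; contradiction; _×-dec_)
open import Relation.Unary using (Pred; Decidable)
open import Relation.Binary.PropositionalEquality
  using (_≡_; refl; sym; trans; cong; cong₂; subst; module ≡-Reasoning)

private
  variable
    m k : ℕ

subsetOf : ∀ {ℓ} {P : Pred (Fin m) ℓ} → Decidable P → Subset m
subsetOf P? = tabulate (λ x → does (P? x))

module _ {ℓ} {P : Pred (Fin m) ℓ} (P? : Decidable P) where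

  ∈-subsetOf⁺ : ∀ {x} → P x → x ∈ subsetOf P?
  ∈-subsetOf⁺ {x} px with P? x in eq
  ... | yes _ = lookup⇒[]= x _ (trans (lookup∘tabulate _ x) (cong does eq))
  ... | no ¬px = contradiction px ¬px

  ∈-subsetOf⁻ : ∀ {x} → x ∈ subsetOf P? → P x
  ∈-subsetOf⁻ {x} x∈ with P? x in eq
  ... | yes px = px
  ... | no _ with () ← trans (sym (trans (lookup∘tabulate _ x) (cong does eq))) ([]=⇒lookup x∈)

drop-∷-Disjoint : ∀ {s t} {p q : Subset m} → Disjoint (s ∷ p) (t ∷ q) → Disjoint p q
drop-∷-Disjoint disj x x∈p x∈q = disj (suc x) (there x∈p) (there x∈q)

∣p∪q∣≡∣p∣+∣q∣ : (p q : Subset m) → Disjoint p q → ∣ p ∪ q ∣ ≡ ∣ p ∣ + ∣ q ∣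
∣p∪q∣≡∣p∣+∣q∣ []            []            _    = refl
∣p∪q∣≡∣p∣+∣q∣ (inside ∷ p)  (inside ∷ q)  disj = contradiction here (disj zero here)
∣p∪q∣≡∣p∣+∣q∣ (inside ∷ p)  (outside ∷ q) disj = cong suc (∣p∪q∣≡∣p∣+∣q∣ p q (drop-∷-Disjoint disj))
∣p∪q∣≡∣p∣+∣q∣ (outside ∷ p) (inside ∷ q)  disj =
  trans (cong suc (∣p∪q∣≡∣p∣+∣q∣ p q (drop-∷-Disjoint disj))) (sym (+-suc ∣ p ∣ ∣ q ∣))
∣p∪q∣≡∣p∣+∣q∣ (outside ∷ p) (outside ∷ q) disj = ∣p∪q∣≡∣p∣+∣q∣ p q (drop-∷-Disjoint disj)

∣p∣≡∣p∩q∣+∣p∩∁q∣ : (p q : Subset m) → ∣ p ∣ ≡ ∣ p ∩ q ∣ + ∣ p ∩ ∁ q ∣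
∣p∣≡∣p∩q∣+∣p∩∁q∣ []            []            = refl
∣p∣≡∣p∩q∣+∣p∩∁q∣ (inside ∷ p)  (inside ∷ q)  = cong suc (∣p∣≡∣p∩q∣+∣p∩∁q∣ p q)
∣p∣≡∣p∩q∣+∣p∩∁q∣ (inside ∷ p)  (outside ∷ q) =
  trans (cong suc (∣p∣≡∣p∩q∣+∣p∩∁q∣ p q)) (sym (+-suc ∣ p ∩ q ∣ ∣ p ∩ ∁ q ∣))
∣p∣≡∣p∩q∣+∣p∩∁q∣ (outside ∷ p) (_ ∷ q)       = ∣p∣≡∣p∩q∣+∣p∩∁q∣ p q

0<∣p∣⇒Nonempty : (p : Subset m) → 0 < ∣ p ∣ → Nonempty p
0<∣p∣⇒Nonempty (inside ∷ p)  _   = zero , here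
0<∣p∣⇒Nonempty (outside ∷ p) 0<∣p∣ with 0<∣p∣⇒Nonempty p 0<∣p∣
... | x , x∈p = suc x , there x∈p

image : (Fin m → Fin k) → Subset m → Subset k
image e []            = ∅
image e (inside ∷ p)  = ⁅ e zero ⁆ ∪ image (e ∘ suc) p
image e (outside ∷ p) = image (e ∘ suc) p

∈-image⁺ : ∀ (e : Fin m → Fin k) {p a} → a ∈ p → e a ∈ image e p
∈-image⁺ e {inside ∷ p}  here        = x∈p∪q⁺ (inj₁ (x∈⁅x⁆ (e zero)))
∈-image⁺ e {inside ∷ p}  (there a∈p) = x∈p∪q⁺ (inj₂ (∈-image⁺ (e ∘ suc) a∈p))
∈-image⁺ e {outside ∷ p} (there a∈p) = ∈-image⁺ (e ∘ suc) a∈p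

∈-image⁻ : ∀ (e : Fin m → Fin k) p {y} → y ∈ image e p → ∃[ a ] a ∈ p × e a ≡ y
∈-image⁻ e []            y∈ = contradiction y∈ ∉∅
∈-image⁻ e (inside ∷ p)  y∈ with x∈p∪q⁻ ⁅ e zero ⁆ (image (e ∘ suc) p) y∈
... | inj₁ y∈⁅e0⁆ = zero , here , sym (x∈⁅y⁆⇒x≡y (e zero) y∈⁅e0⁆)
... | inj₂ y∈img  with ∈-image⁻ (e ∘ suc) p y∈img
...   | a , a∈p , refl = suc a , there a∈p , refl
∈-image⁻ e (outside ∷ p) y∈ with ∈-image⁻ (e ∘ suc) p y∈
... | a , a∈p , refl = suc a , there a∈p , refl

∣image∣≡∣p∣ : ∀ {e : Fin m → Fin k} → Injective _≡_ _≡_ e → (p : Subset m) → ∣ image e p ∣ ≡ ∣ p ∣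
∣image∣≡∣p∣ {k = k} e-inj [] = ∣∅∣≡0 k
∣image∣≡∣p∣ {e = e} e-inj (inside ∷ p) = begin
  ∣ ⁅ e zero ⁆ ∪ image (e ∘ suc) p ∣      ≡⟨ ∣p∪q∣≡∣p∣+∣q∣ _ _ e0∉ ⟩
  ∣ ⁅ e zero ⁆ ∣ + ∣ image (e ∘ suc) p ∣  ≡⟨ cong₂ _+_ (∣⁅x⁆∣≡1 (e zero))
                                                     (∣image∣≡∣p∣ (suc-injective ∘ e-inj) p) ⟩
  suc ∣ p ∣                               ∎
  where
  open ≡-Reasoning
  e0∉ : Disjoint ⁅ e zero ⁆ (image (e ∘ suc) p)
  e0∉ y y∈⁅e0⁆ y∈img with ∈-image⁻ (e ∘ suc) p y∈img
  ... | a , _ , refl = 0≢1+n (e-inj (sym (x∈⁅y⁆⇒x≡y (e zero) y∈⁅e0⁆)))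
∣image∣≡∣p∣ e-inj (outside ∷ p) = ∣image∣≡∣p∣ (suc-injective ∘ e-inj) p

choose : (p : Subset m) → Nonempty p → Fin m
choose p ne with nonempty? p
... | yes (x , _) = x
... | no  empty   = contradiction ne empty

choose-∈ : ∀ (p : Subset m) ne → choose p ne ∈ p
choose-∈ p ne with nonempty? p
... | yes (_ , x∈p) = x∈p
... | no  empty     = contradiction ne empty

choose-cong : ∀ {p q : Subset m} → p ≡ q → ∀ ne ne′ → choose p ne ≡ choose q ne′
choose-cong {p = p} refl ne _ with nonempty? p
... | yes _     = refl
... | no  empty = contradiction ne empty

enumerate : (p : Subset m) → Fin ∣ p ∣ → Fin m
enumerate (inside ∷ p)  zero    = zero
enumerate (inside ∷ p)  (suc i) = suc (enumerate p i)
enumerate (outside ∷ p) i       = suc (enumerate p i)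

enumerate-∈ : ∀ (p : Subset m) i → enumerate p i ∈ p
enumerate-∈ (inside ∷ p)  zero    = here
enumerate-∈ (inside ∷ p)  (suc i) = there (enumerate-∈ p i)
enumerate-∈ (outside ∷ p) i       = there (enumerate-∈ p i)

enumerate-injective : ∀ (p : Subset m) → Injective _≡_ _≡_ (enumerate p)
enumerate-injective (inside ∷ p)  {zero}  {zero}  _  = refl
enumerate-injective (inside ∷ p)  {suc i} {suc j} eq =
  cong suc (enumerate-injective p (suc-injective eq))
enumerate-injective (outside ∷ p)                 eq = enumerate-injective p (suc-injective eq)

enumerate-surjective : ∀ (p : Subset m) {x} → x ∈ p → ∃[ i ] enumerate p i ≡ x
enumerate-surjective (inside ∷ p)  here        = zero , refl
enumerate-surjective (inside ∷ p)  (there x∈p) with enumerate-surjective p x∈p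
... | i , refl = suc i , refl
enumerate-surjective (outside ∷ p) (there x∈p) with enumerate-surjective p x∈p
... | i , refl = i , refl

Adj-sym : (G : Graph) {x y : Fin (n G)} → Adj G x y → Adj G y x
Adj-sym G {x} {y} = trans (Graph.sym G y x)

Closed : (G : Graph) → Subset (n G) → Set
Closed G C = ∀ {x y} → x ∈ C → Adj G x y → y ∈ C

replaceOn : Subset m → Subset m → Subset m → Subset m
replaceOn C S T = S ∩ C ∪ T ∩ ∁ C

∈-replaceOn⁻ : ∀ (C S T : Subset m) {x} → x ∈ replaceOn C S T → (x ∈ S × x ∈ C) ⊎ (x ∈ T × x ∉ C)
∈-replaceOn⁻ C S T x∈ with x∈p∪q⁻ (S ∩ C) (T ∩ ∁ C) x∈
... | inj₁ x∈S∩C  = inj₁ (x∈p∩q⁻ S C x∈S∩C)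
... | inj₂ x∈T∩∁C with x∈p∩q⁻ T (∁ C) x∈T∩∁C
...   | x∈T , x∈∁C = inj₂ (x∈T , x∈∁p⇒x∉p x∈∁C)

∣replaceOn∣ : ∀ (C S T : Subset m) → ∣ replaceOn C S T ∣ ≡ ∣ S ∩ C ∣ + ∣ T ∩ ∁ C ∣
∣replaceOn∣ C S T = ∣p∪q∣≡∣p∣+∣q∣ (S ∩ C) (T ∩ ∁ C) λ x x∈S∩C x∈T∩∁C →
  x∈∁p⇒x∉p (proj₂ (x∈p∩q⁻ T (∁ C) x∈T∩∁C)) (proj₂ (x∈p∩q⁻ S C x∈S∩C))

module _ (G : Graph) {C : Subset (n G)} where

  replaceOn-independent : ∀ {S T} → Closed G C → Independent G S → Independent G T →
                          Independent G (replaceOn C S T)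
  replaceOn-independent {S} {T} C-closed S-ind T-ind x y x∈ y∈ xy
    with ∈-replaceOn⁻ C S T x∈ | ∈-replaceOn⁻ C S T y∈
  ... | inj₁ (x∈S , _)   | inj₁ (y∈S , _)   = S-ind x y x∈S y∈S xy
  ... | inj₁ (_ , x∈C)   | inj₂ (_ , y∉C)   = y∉C (C-closed x∈C xy)
  ... | inj₂ (_ , x∉C)   | inj₁ (_ , y∈C)   = x∉C (C-closed y∈C (Adj-sym G xy))
  ... | inj₂ (x∈T , _)   | inj₂ (y∈T , _)   = T-ind x y x∈T y∈T xy

  maximum-on-closed : ∀ {S T} → MaximumIndependent G S → Closed G C → Independent G T →
                      ∣ T ∩ C ∣ ≤ ∣ S ∩ C ∣
  maximum-on-closed {S} {T} (S-ind , S-max) C-closed T-ind = +-cancelʳ-≤ ∣ S ∩ ∁ C ∣ _ _ (begin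
    ∣ T ∩ C ∣ + ∣ S ∩ ∁ C ∣  ≡⟨ sym (∣replaceOn∣ C T S) ⟩
    ∣ replaceOn C T S ∣      ≤⟨ S-max _ (replaceOn-independent C-closed T-ind S-ind) ⟩
    ∣ S ∣                    ≡⟨ ∣p∣≡∣p∩q∣+∣p∩∁q∣ S C ⟩
    ∣ S ∩ C ∣ + ∣ S ∩ ∁ C ∣  ∎)
    where open ≤-Reasoning

∣T∣≤∣replaceOn∣ : ∀ (C S T : Subset m) → ∣ T ∩ C ∣ ≤ ∣ S ∩ C ∣ → ∣ T ∣ ≤ ∣ replaceOn C S T ∣
∣T∣≤∣replaceOn∣ C S T ∣T∩C∣≤∣S∩C∣ = begin
  ∣ T ∣                    ≡⟨ ∣p∣≡∣p∩q∣+∣p∩∁q∣ T C ⟩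
  ∣ T ∩ C ∣ + ∣ T ∩ ∁ C ∣  ≤⟨ +-monoˡ-≤ ∣ T ∩ ∁ C ∣ ∣T∩C∣≤∣S∩C∣ ⟩
  ∣ S ∩ C ∣ + ∣ T ∩ ∁ C ∣  ≡⟨ sym (∣replaceOn∣ C S T) ⟩
  ∣ replaceOn C S T ∣      ∎
  where open ≤-Reasoning

-- Replacing T by S on C x for each vertex x in turn never shrinks T and ends inside S.
locally-maximum⇒maximum : (G : Graph) {S : Subset (n G)} (C : Fin (n G) → Subset (n G)) →
  (∀ x → x ∈ C x) → (∀ x → Closed G (C x)) → Independent G S →
  (∀ x T → Independent G T → ∣ T ∩ C x ∣ ≤ ∣ S ∩ C x ∣) → MaximumIndependent G S
locally-maximum⇒maximum G {S} C x∈Cx C-closed S-ind S-locmax = S-ind , λ T T-ind → begin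
  ∣ T ∣                    ≤⟨ sweep-grows (allFin _) T-ind ⟩
  ∣ sweep (allFin _) T ∣   ≤⟨ p⊆q⇒∣p∣≤∣q∣ (λ {y} → sweep-agrees (allFin _) (∈-allFin y)) ⟩
  ∣ S ∣                    ∎
  where
  open ≤-Reasoning

  sweep : List (Fin (n G)) → Subset (n G) → Subset (n G)
  sweep xs T = foldr (λ x → replaceOn (C x) S) T xs

  sweep-independent : ∀ xs {T} → Independent G T → Independent G (sweep xs T)
  sweep-independent []       T-ind = T-ind
  sweep-independent (x ∷ xs) T-ind =
    replaceOn-independent G (C-closed x) S-ind (sweep-independent xs T-ind)

  sweep-grows : ∀ xs {T} → Independent G T → ∣ T ∣ ≤ ∣ sweep xs T ∣
  sweep-grows []       _     = ≤-refl
  sweep-grows (x ∷ xs) T-ind = ≤-trans (sweep-grows xs T-ind)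
    (∣T∣≤∣replaceOn∣ (C x) S _ (S-locmax x _ (sweep-independent xs T-ind)))

  sweep-agrees : ∀ xs {T y} → y ∈L xs → y ∈ sweep xs T → y ∈ S
  sweep-agrees (x ∷ xs) {T} y∈xs y∈ with ∈-replaceOn⁻ (C x) S (sweep xs T) y∈ | y∈xs
  ... | inj₁ (y∈S , _)       | _              = y∈S
  ... | inj₂ (_ , y∉C)       | Any.here refl  = contradiction (x∈Cx x) y∉C
  ... | inj₂ (y∈sweep , _)   | Any.there y∈xs′ = sweep-agrees xs y∈xs′ y∈sweep

∅-independent : (G : Graph) → Independent G ∅
∅-independent G x _ x∈∅ = contradiction x∈∅ ∉∅

⁅⁆-independent : (G : Graph) (v : Fin (n G)) → Independent G ⁅ v ⁆
⁅⁆-independent G v x y x∈ y∈ xy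
  with refl ← x∈⁅y⁆⇒x≡y v x∈ | refl ← x∈⁅y⁆⇒x≡y v y∈ =
  contradiction (trans (sym (loopless G x)) xy) λ ()

disjoint-maximum⇒≤ : ∀ {p} (G : Graph) → 1 ≤ n G → (S : Fin p → Subset (n G)) →
  (∀ i → MaximumIndependent G (S i)) → PairwiseDisjoint S → p ≤ n G
disjoint-maximum⇒≤ {p} G 1≤n S S-max S-disj = injective⇒≤ {f = member} member-injective
  where
  nonempty : ∀ i → Nonempty (S i)
  nonempty i = 0<∣p∣⇒Nonempty (S i)
    (≤-trans (≤-reflexive (sym (∣⁅x⁆∣≡1 (fromℕ< 1≤n))))
             (proj₂ (S-max i) _ (⁅⁆-independent G (fromℕ< 1≤n))))

  member : Fin p → Fin (n G)
  member i = proj₁ (nonempty i)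

  member-injective : Injective _≡_ _≡_ member
  member-injective {i} {j} mi≡mj with i ≟ j
  ... | yes i≡j = i≡j
  ... | no  i≢j = contradiction (subst (_∈ S j) (sym mi≡mj) (proj₂ (nonempty j)))
                                (S-disj i j i≢j (member i) (proj₂ (nonempty i)))

MaximumExtension : ∀ {p} (G : Graph) → (Fin p → Subset (n G)) → Set
MaximumExtension {p} G A = Σ (Fin p → Subset (n G)) λ S →
  (∀ i → MaximumIndependent G (S i)) × PairwiseDisjoint S × (∀ i → A i ⊆ S i)

Extendable : ℕ → Graph → Set
Extendable p G = (A : Fin p → Subset (n G)) → (∀ i → Independent G (A i)) →
  PairwiseDisjoint A → MaximumExtension G A

extendable⇒W : ∀ {p} (G : Graph) → 1 ≤ n G → Extendable p G → W p G
extendable⇒W G 1≤n extend =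
  let S , S-max , S-disj , _ =
        extend (λ _ → ∅) (λ _ → ∅-independent G) (λ _ _ _ _ x∈∅ → contradiction x∈∅ ∉∅)
  in disjoint-maximum⇒≤ G 1≤n S S-max S-disj , extend

module Component {H G : Graph} (c : IsComponent H G) where
  open IsComponent c

  range : Subset (n G)
  range = image emb ⊤

  range-closed : Closed G range
  range-closed x∈ xy with ∈-image⁻ emb ⊤ x∈
  ... | a , _ , refl with closed a _ xy
  ...   | b , refl = ∈-image⁺ emb ∈⊤

  image⊆range : ∀ T → image emb T ⊆ range
  image⊆range T y∈ with ∈-image⁻ emb T y∈
  ... | a , _ , refl = ∈-image⁺ emb ∈⊤

  preimage : Subset (n G) → Subset (n H)
  preimage T = subsetOf (λ a → emb a ∈? T)

  ∈-preimage⁺ : ∀ {T a} → emb a ∈ T → a ∈ preimage T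
  ∈-preimage⁺ {T} = ∈-subsetOf⁺ (λ a → emb a ∈? T)

  ∈-preimage⁻ : ∀ {T a} → a ∈ preimage T → emb a ∈ T
  ∈-preimage⁻ {T} = ∈-subsetOf⁻ (λ a → emb a ∈? T)

  image-independent : ∀ {T} → Independent H T → Independent G (image emb T)
  image-independent {T} T-ind x y x∈ y∈ xy with ∈-image⁻ emb T x∈ | ∈-image⁻ emb T y∈
  ... | a , a∈T , refl | b , b∈T , refl = T-ind a b a∈T b∈T (trans (induced a b) xy)

  preimage-independent : ∀ {T} → Independent G T → Independent H (preimage T)
  preimage-independent T-ind a b a∈ b∈ ab =
    T-ind (emb a) (emb b) (∈-preimage⁻ a∈) (∈-preimage⁻ b∈) (trans (sym (induced a b)) ab)

  image-disjoint : ∀ {p} {A : Fin p → Subset (n H)} → PairwiseDisjoint A →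
                   PairwiseDisjoint (image emb ∘ A)
  image-disjoint {A = A} A-disj i j i≢j y y∈i y∈j
    with ∈-image⁻ emb (A i) y∈i | ∈-image⁻ emb (A j) y∈j
  ... | a , a∈ , refl | b , b∈ , ea≡eb with injective ea≡eb
  ...   | refl = A-disj i j i≢j a a∈ b∈

  preimage-disjoint : ∀ {p} {S : Fin p → Subset (n G)} → PairwiseDisjoint S →
                      PairwiseDisjoint (preimage ∘ S)
  preimage-disjoint S-disj i j i≢j a a∈i a∈j =
    S-disj i j i≢j (emb a) (∈-preimage⁻ a∈i) (∈-preimage⁻ a∈j)

  ∣∩range∣≤∣preimage∣ : ∀ T → ∣ T ∩ range ∣ ≤ ∣ preimage T ∣
  ∣∩range∣≤∣preimage∣ T =
    ≤-trans (p⊆q⇒∣p∣≤∣q∣ ∩range⊆) (≤-reflexive (∣image∣≡∣p∣ injective (preimage T)))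
    where
    ∩range⊆ : T ∩ range ⊆ image emb (preimage T)
    ∩range⊆ y∈ with x∈p∩q⁻ T range y∈
    ... | y∈T , y∈range with ∈-image⁻ emb ⊤ y∈range
    ...   | a , _ , refl = ∈-image⁺ emb (∈-preimage⁺ y∈T)

  preimage-maximum : ∀ {S} → MaximumIndependent G S → MaximumIndependent H (preimage S)
  preimage-maximum {S} S-max = preimage-independent (proj₁ S-max) , λ T T-ind → begin
    ∣ T ∣                      ≡⟨ sym (∣image∣≡∣p∣ injective T) ⟩
    ∣ image emb T ∣            ≤⟨ p⊆q⇒∣p∣≤∣q∣ (λ y∈ → x∈p∩q⁺ (y∈ , image⊆range T y∈)) ⟩
    ∣ image emb T ∩ range ∣    ≤⟨ maximum-on-closed G S-max range-closed (image-independent T-ind) ⟩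
    ∣ S ∩ range ∣              ≤⟨ ∣∩range∣≤∣preimage∣ S ⟩
    ∣ preimage S ∣             ∎
    where open ≤-Reasoning

  extendable : ∀ {p} → Extendable p G → Extendable p H
  extendable extend A A-ind A-disj
    with extend (image emb ∘ A) (image-independent ∘ A-ind) (image-disjoint A-disj)
  ... | S , S-max , S-disj , A⊆S =
    preimage ∘ S , preimage-maximum ∘ S-max , preimage-disjoint S-disj ,
    λ i a∈A → ∈-preimage⁺ (A⊆S i (∈-image⁺ emb a∈A))

W-component : ∀ {p} {H G : Graph} → IsComponent H G → W p G → W p H
W-component {H = H} c (_ , extend) =
  extendable⇒W H (proj₁ (IsComponent.connected c)) (Component.extendable c extend)

module _ {G : Graph} where

  Reachable-snoc : ∀ {x y z} → Reachable G x y → Adj G y z → Reachable G x z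
  Reachable-snoc here         yz = step yz here
  Reachable-snoc (step xw wy) yz = step xw (Reachable-snoc wy yz)

  Reachable-trans : ∀ {x y z} → Reachable G x y → Reachable G y z → Reachable G x z
  Reachable-trans here         yz = yz
  Reachable-trans (step xw wy) yz = step xw (Reachable-trans wy yz)

  Reachable-sym : ∀ {x y} → Reachable G x y → Reachable G y x
  Reachable-sym here         = here
  Reachable-sym (step xw wy) = Reachable-snoc (Reachable-sym wy) (Adj-sym G xw)

  closed-reachable : ∀ {C x y} → Closed G C → x ∈ C → Reachable G x y → y ∈ C
  closed-reachable C-closed x∈C here         = x∈C
  closed-reachable C-closed x∈C (step xw wy) = closed-reachable C-closed (C-closed x∈C xw) wy

_[_] : (G : Graph) → Subset (n G) → Graph
G [ V ] = record
  { n        = ∣ V ∣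
  ; adj      = λ a b → adj G (enumerate V a) (enumerate V b)
  ; sym      = λ a b → Graph.sym G (enumerate V a) (enumerate V b)
  ; loopless = λ a → loopless G (enumerate V a)
  }

module _ {G : Graph} {V : Subset (n G)} (V-closed : Closed G V) where

  lift-walk : ∀ {x y} → Reachable G x y →
              ∀ {a b} → enumerate V a ≡ x → enumerate V b ≡ y → Reachable (G [ V ]) a b
  lift-walk here {a} {b} refl eb with enumerate-injective V eb
  ... | refl = here
  lift-walk (step xz zy) {a} refl eb with enumerate-surjective V (V-closed (enumerate-∈ V a) xz)
  ... | c , refl = step xz (lift-walk zy refl eb)

  closed-connected⇒component : ∀ {v} → v ∈ V → (∀ {y} → y ∈ V → Reachable G v y) →
                                IsComponent (G [ V ]) G
  closed-connected⇒component {v} v∈V reach = record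
    { emb       = enumerate V
    ; injective = enumerate-injective V
    ; induced   = λ _ _ → refl
    ; connected = ≤-trans (s≤s z≤n) (toℕ<n (proj₁ (enumerate-surjective V v∈V))) , λ a b →
        lift-walk (Reachable-trans (Reachable-sym (reach (enumerate-∈ V a)))
                                   (reach (enumerate-∈ V b))) refl refl
    ; closed    = λ a y ay → enumerate-surjective V (V-closed (enumerate-∈ V a) ay)
    }

module Connectivity (G : Graph) where

  adjacentTo? : (C : Subset (n G)) → Decidable (λ y → ∃[ x ] x ∈ C × Adj G x y)
  adjacentTo? C y = any? (λ x → x ∈? C ×-dec adj G x y Bool.≟ Bool.true)

  neighbours : Subset (n G) → Subset (n G)
  neighbours C = subsetOf (adjacentTo? C)

  ∈-neighbours⁺ : ∀ {C x y} → x ∈ C → Adj G x y → y ∈ neighbours C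
  ∈-neighbours⁺ {C} x∈C xy = ∈-subsetOf⁺ (adjacentTo? C) (_ , x∈C , xy)

  ∈-neighbours⁻ : ∀ {C y} → y ∈ neighbours C → ∃[ x ] x ∈ C × Adj G x y
  ∈-neighbours⁻ {C} = ∈-subsetOf⁻ (adjacentTo? C)

  expand : Subset (n G) → Subset (n G)
  expand C = C ∪ neighbours C

  ⊆-expand : ∀ C → C ⊆ expand C
  ⊆-expand C = p⊆p∪q (neighbours C)

  closed⇒expand⊆ : ∀ {C} → Closed G C → expand C ⊆ C
  closed⇒expand⊆ {C} C-closed y∈ with x∈p∪q⁻ C (neighbours C) y∈
  ... | inj₁ y∈C = y∈C
  ... | inj₂ y∈N with ∈-neighbours⁻ y∈N
  ...   | x , x∈C , xy = C-closed x∈C xy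

  expand⊆⇒closed : ∀ {C} → expand C ⊆ C → Closed G (expand C)
  expand⊆⇒closed E⊆C x∈ xy = x∈p∪q⁺ (inj₂ (∈-neighbours⁺ (E⊆C x∈) xy))

  ball : Fin (n G) → ℕ → Subset (n G)
  ball v zero    = ⁅ v ⁆
  ball v (suc k) = expand (ball v k)

  ball-closed-or-large : ∀ v k → Closed G (ball v k) ⊎ k < ∣ ball v k ∣
  ball-closed-or-large v zero = inj₂ (≤-reflexive (sym (∣⁅x⁆∣≡1 v)))
  ball-closed-or-large v (suc k) with ball-closed-or-large v k
  ... | inj₁ B-closed = inj₁ (expand⊆⇒closed (closed⇒expand⊆ B-closed))
  ... | inj₂ k<∣B∣ with ball v k ⊂? ball v (suc k)
  ...   | yes B⊂E = inj₂ (≤-trans (s≤s k<∣B∣) (p⊂q⇒∣p∣<∣q∣ B⊂E))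
  ...   | no  B⊄E = inj₁ (expand⊆⇒closed E⊆B)
    where
    E⊆B : expand (ball v k) ⊆ ball v k
    E⊆B {x} x∈E with x ∈? ball v k
    ... | yes x∈B = x∈B
    ... | no  x∉B = ⊥-elim (B⊄E (⊆-expand (ball v k) , x , x∈E , x∉B))

  ball-reachable : ∀ {v} k {y} → y ∈ ball v k → Reachable G v y
  ball-reachable {v} zero y∈ with refl ← x∈⁅y⁆⇒x≡y v y∈ = here
  ball-reachable {v} (suc k) {y} y∈ with x∈p∪q⁻ (ball v k) _ y∈
  ... | inj₁ y∈B = ball-reachable k y∈B
  ... | inj₂ y∈N with ∈-neighbours⁻ y∈N
  ...   | x , x∈B , xy = Reachable-snoc (ball-reachable k x∈B) xy

  ∈-ball : ∀ v k → v ∈ ball v k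
  ∈-ball v zero    = x∈⁅x⁆ v
  ∈-ball v (suc k) = ⊆-expand (ball v k) (∈-ball v k)

  -- A ball that is not closed is strictly contained in the next one, so ball v (n G) is closed.
  component : Fin (n G) → Subset (n G)
  component v = ball v (n G)

  component-closed : ∀ {v} → Closed G (component v)
  component-closed {v} with ball-closed-or-large v (n G)
  ... | inj₁ closed  = closed
  ... | inj₂ n<∣B∣   = contradiction (∣p∣≤n (component v)) (<⇒≱ n<∣B∣)

  ∈-component : ∀ v → v ∈ component v
  ∈-component v = ∈-ball v (n G)

  ∈-component⁺ : ∀ {v y} → Reachable G v y → y ∈ component v
  ∈-component⁺ = closed-reachable component-closed (∈-component _)

  ∈-component⁻ : ∀ {v y} → y ∈ component v → Reachable G v y
  ∈-component⁻ = ball-reachable (n G)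

  component-cong : ∀ {x y} → Reachable G x y → component x ≡ component y
  component-cong xy = ⊆-antisym
    (λ z∈ → ∈-component⁺ (Reachable-trans (Reachable-sym xy) (∈-component⁻ z∈)))
    (λ z∈ → ∈-component⁺ (Reachable-trans xy (∈-component⁻ z∈)))

  root : Fin (n G) → Fin (n G)
  root y = choose (component y) (y , ∈-component y)

  root-cong : ∀ {x y} → Reachable G x y → root x ≡ root y
  root-cong xy = choose-cong (component-cong xy) _ _

  reachable-root : ∀ x → Reachable G x (root x)
  reachable-root x = ∈-component⁻ (choose-∈ (component x) (x , ∈-component x))

  ∈-component-root : ∀ y → y ∈ component (root y)
  ∈-component-root y = ∈-component⁺ (Reachable-sym (reachable-root y))

  ∈-component-root⇒root≡ : ∀ {x y} → y ∈ component (root x) → root x ≡ root y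
  ∈-component-root⇒root≡ {x} y∈ = root-cong (Reachable-trans (reachable-root x) (∈-component⁻ y∈))

module Gluing {p} (G : Graph) (extend : ∀ H → IsComponent H G → Extendable p H)
              (A : Fin p → Subset (n G)) (A-ind : ∀ i → Independent G (A i))
              (A-disj : PairwiseDisjoint A) where
  open Connectivity G

  -- Local solutions are indexed by roots, so that all vertices of a component use the same
  -- one: extend may answer differently for different proofs that a set is a component.
  module Local (r : Fin (n G)) where
    isComponent : IsComponent (G [ component r ]) G
    isComponent = closed-connected⇒component component-closed (∈-component r) ∈-component⁻

    open Component isComponent public

    extension : MaximumExtension (G [ component r ]) (preimage ∘ A)
    extension =
      extend _ isComponent (preimage ∘ A) (preimage-independent ∘ A-ind) (preimage-disjoint A-disj)

    S : Fin p → Subset ∣ component r ∣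
    S = proj₁ extension

    S-maximum : ∀ i → MaximumIndependent (G [ component r ]) (S i)
    S-maximum = proj₁ (proj₂ extension)

    S-disjoint : PairwiseDisjoint S
    S-disjoint = proj₁ (proj₂ (proj₂ extension))

    preimage-A⊆S : ∀ i → preimage (A i) ⊆ S i
    preimage-A⊆S = proj₂ (proj₂ (proj₂ extension))

    lifted : Fin p → Subset (n G)
    lifted i = image (enumerate (component r)) (S i)

    component⊆range : component r ⊆ range
    component⊆range y∈ with enumerate-surjective (component r) y∈
    ... | a , refl = ∈-image⁺ (enumerate (component r)) ∈⊤

  glued : Fin p → Subset (n G)
  glued i = subsetOf (λ y → y ∈? Local.lifted (root y) i)

  ∈-glued⁺ : ∀ {i y} → y ∈ Local.lifted (root y) i → y ∈ glued i
  ∈-glued⁺ {i} = ∈-subsetOf⁺ (λ y → y ∈? Local.lifted (root y) i)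

  ∈-glued⁻ : ∀ {i y} → y ∈ glued i → y ∈ Local.lifted (root y) i
  ∈-glued⁻ {i} = ∈-subsetOf⁻ (λ y → y ∈? Local.lifted (root y) i)

  glued-independent : ∀ i → Independent G (glued i)
  glued-independent i x y x∈ y∈ xy =
    Local.image-independent (root x) (proj₁ (Local.S-maximum (root x) i)) x y (∈-glued⁻ x∈)
      (subst (λ r → y ∈ Local.lifted r i) (sym (root-cong (step xy here))) (∈-glued⁻ y∈)) xy

  glued-disjoint : PairwiseDisjoint glued
  glued-disjoint i j i≢j y y∈i y∈j =
    Local.image-disjoint (root y) (Local.S-disjoint (root y)) i j i≢j y
      (∈-glued⁻ y∈i) (∈-glued⁻ y∈j)

  A⊆glued : ∀ i → A i ⊆ glued i
  A⊆glued i {y} y∈A with enumerate-surjective (component (root y)) (∈-component-root y)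
  ... | a , ea≡y = ∈-glued⁺ (subst (_∈ Local.lifted (root y) i) ea≡y
        (∈-image⁺ _ (Local.preimage-A⊆S (root y) i
          (Local.∈-preimage⁺ (root y) (subst (_∈ A i) (sym ea≡y) y∈A)))))

  glued-maximum : ∀ i → MaximumIndependent G (glued i)
  glued-maximum i = locally-maximum⇒maximum G (component ∘ root) ∈-component-root
    (λ _ → component-closed) (glued-independent i) bound
    where
    bound : ∀ x T → Independent G T → ∣ T ∩ component (root x) ∣ ≤ ∣ glued i ∩ component (root x) ∣
    bound x T T-ind = begin
      ∣ T ∩ V ∣                  ≤⟨ p⊆q⇒∣p∣≤∣q∣ (λ y∈ → let y∈T , y∈V = x∈p∩q⁻ T V y∈ in
                                      x∈p∩q⁺ (y∈T , component⊆range y∈V)) ⟩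
      ∣ T ∩ range ∣              ≤⟨ ∣∩range∣≤∣preimage∣ T ⟩
      ∣ preimage T ∣             ≤⟨ proj₂ (S-maximum i) _ (preimage-independent T-ind) ⟩
      ∣ S i ∣                    ≡⟨ sym (∣image∣≡∣p∣ (enumerate-injective V) (S i)) ⟩
      ∣ lifted i ∣               ≤⟨ p⊆q⇒∣p∣≤∣q∣ lifted⊆glued∩V ⟩
      ∣ glued i ∩ V ∣            ∎
      where
      open ≤-Reasoning
      open Local (root x)
      V : Subset (n G)
      V = component (root x)
      lifted⊆glued∩V : lifted i ⊆ glued i ∩ V
      lifted⊆glued∩V {y} y∈ with ∈-image⁻ (enumerate V) (S i) y∈
      ... | a , _ , refl = x∈p∩q⁺ (∈-glued⁺ (subst (λ r → y ∈ Local.lifted r i)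
                             (∈-component-root⇒root≡ (enumerate-∈ V a)) y∈) , enumerate-∈ V a)

extendable-from-components : ∀ {p} (G : Graph) → (∀ H → IsComponent H G → Extendable p H) →
                             Extendable p G
extendable-from-components G extend A A-ind A-disj =
  glued , glued-maximum , glued-disjoint , A⊆glued
  where open Gluing G extend A A-ind A-disj

theorem2p6 : (p : ℕ) → 1 ≤ p → (G : Graph) → 1 ≤ n G →
    W p G ⇔ ((H : Graph) → IsComponent H G → W p H)
theorem2p6 p _ G 1≤n = mk⇔
  (λ W-G H c → W-component c W-G)
  (λ W-components → extendable⇒W G 1≤n
    (extendable-from-components G (λ H c → proj₂ (W-components H c))))
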